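{- Let $*:\mathbb R^d\times\mathbb R^d\to\mathbb R^d$ be a bilinear map with nonnegative coefficients and $s\in\mathbb R^d$ a nonnegative vector, with associated function $g$. Then there exist $d'$, a bilinear map $*':\mathbb R^{d'}\times\mathbb R^{d'}\to\mathbb R^{d'}$ with nonnegative coefficients and a nonnegative vector $s'\in\mathbb R^{d'}$, with associated function $g'$, such that for every $m\ge1$ we have $g'(2m+1)=0$ and $g'(2m)=g(m)$.
   Context: A bilinear map $*$ is given by coefficients $c^{(k)}_{i,j}$ via $(x*y)_k=\sum_{i,j}c^{(k)}_{i,j}x_iy_j$. A combination of $n$ instances of $s$ is defined recursively: for $n=1$ the only combination is $s$; for $n\ge 2$ the combinations are the expressions $X*Y$ with $X$ a combination of $n_1$ instances and $Y$ a combination of $n_2$ instances of $s$, $n_1,n_2\ge1$, $n_1+n_2=n$. The function $g(n)$ of the system $(*,s)$ is the largest entry of any vector obtained from a combination of $n$ instances of $s$ (and analogously $g'$ for $(*',s')$). -}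

module Defs where

open import Level using (Level; _⊔_) renaming (suc to lsuc)
open import Algebra.Bundles using (CommutativeSemiring)
open import Relation.Binary.Structures using (IsDecTotalOrder)
open import Data.Nat using (ℕ; zero; suc) renaming (_+_ to _+ℕ_)
open import Data.Fin using (Fin; zero; suc)
open import Data.Product using (Σ; _×_; _,_)
open import Function.Bundles using (_⇔_)

-- An ordered commutative semiring with a decidable total order, compatible
-- with + and * in the usual way (the real numbers are the intended instance).
record OrderedCommSemiring (c ℓ₁ ℓ₂ : Level) : Set (lsuc (c ⊔ ℓ₁ ⊔ ℓ₂)) where
  field
    commutativeSemiring : CommutativeSemiring c ℓ₁
  open CommutativeSemiring commutativeSemiring public
  infix 4 _≤_
  field
    _≤_ : Carrier → Carrier → Set ℓ₂
    isDecTotalOrder : IsDecTotalOrder _≈_ _≤_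
    +-monoˡ-≤ : ∀ {a b} (c : Carrier) → a ≤ b → a + c ≤ b + c
    *-monoˡ-≤ : ∀ {a b c} → 0# ≤ a → b ≤ c → a * b ≤ a * c

module _ {c ℓ₁ ℓ₂ : Level} (R : OrderedCommSemiring c ℓ₁ ℓ₂) where
  open OrderedCommSemiring R using (Carrier; _≈_; _≤_; _+_; _*_; 0#)

  Vect : ℕ → Set c
  Vect d = Fin d → Carrier

  sumFin : (d : ℕ) → (Fin d → Carrier) → Carrier
  sumFin zero    f = 0#
  sumFin (suc d) f = f zero + sumFin d (λ i → f (suc i))

  -- a bilinear map R^d × R^d → R^d, given by coefficients  coef k i j = c^{(k)}_{i,j}
  Bilinear : ℕ → Set c
  Bilinear d = Fin d → Fin d → Fin d → Carrier

  apply : {d : ℕ} → Bilinear d → Vect d → Vect d → Vect d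
  apply {d} coef x y k = sumFin d (λ i → sumFin d (λ j → (coef k i j * x i) * y j))

  NonnegCoeffs : {d : ℕ} → Bilinear d → Set ℓ₂
  NonnegCoeffs {d} coef = ∀ k i j → 0# ≤ coef k i j

  NonnegVect : {d : ℕ} → Vect d → Set ℓ₂
  NonnegVect {d} s = ∀ i → 0# ≤ s i

  -- combinations of n instances of s (binary trees with n leaves)
  data Comb : ℕ → Set where
    leaf : Comb 1
    node : {n₁ n₂ : ℕ} → Comb n₁ → Comb n₂ → Comb (n₁ +ℕ n₂)

  eval : {d : ℕ} → Bilinear d → Vect d → {n : ℕ} → Comb n → Vect d
  eval coef s leaf       = s
  eval coef s (node X Y) = apply coef (eval coef s X) (eval coef s Y)

  -- "v = g(n)": v is the largest entry of any vector obtained from a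
  -- combination of n instances of s (attained, and an upper bound).
  IsG : {d : ℕ} → Bilinear d → Vect d → ℕ → Carrier → Set (ℓ₁ ⊔ ℓ₂)
  IsG {d} coef s n v =
    Σ (Comb n) (λ X → Σ (Fin d) (λ k → eval coef s X k ≈ v))
    × (∀ (X : Comb n) (k : Fin d) → eval coef s X k ≤ v)

-- Add a marker coordinate 0 in front of the d coordinates of *.  The seed is
-- s′ = (t, 0, …, 0) with t = 1 (or t = 0 in the degenerate case 1 ≤ 0, where
-- s = 0), and *′ is zero on the marker coordinate, acts as * on the remaining
-- ones, and additionally sends (marker, marker) to s.  Then s′ *′ s′ = (0, s),
-- and by induction a combination of n copies of s′ is s′ itself (n = 1), the
-- zero vector, or (0, v) with n = 2m and v obtained from a combination of m
-- copies of s; doubling every leaf shows that every such v occurs.  Hence odd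
-- degrees ≥ 3 produce only zero vectors, while degree 2m produces the entries
-- of degree m together with zeros, which do not change the maximum because all
-- entries are nonnegative.
module Submission where

open import Defs
open import Level using (Level; _⊔_)
open import Data.Nat using (ℕ; suc; _+_; _*_; _≤_)
open import Data.Nat.Properties using (*-distribˡ-+; *-cancelˡ-≡; +-cancelʳ-≡)
open import Data.Nat.Divisibility using (_∣_; m∣m*n; ∣m+n∣m⇒∣n; ∣1⇒≡1)
open import Data.Fin using (Fin; zero; suc)
open import Data.Vec.Functional using (head; tail)
open import Data.Product using (Σ; _×_; _,_; proj₁; proj₂)
open import Data.Sum using (_⊎_; inj₁; inj₂)
open import Data.Empty using (⊥-elim)
open import Function.Base using (_∘_)
open import Function.Bundles using (_⇔_; mk⇔)
open import Relation.Binary.Structures using (IsDecTotalOrder)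
import Relation.Binary.Reasoning.Setoid as ≈-Reasoning
import Relation.Binary.PropositionalEquality as ≡
open ≡ using (_≡_; _≢_)

2*m≢2*n+1 : ∀ m n → 2 * m ≢ 2 * n + 1
2*m≢2*n+1 m n 2m≡2n+1
  with ∣1⇒≡1 (∣m+n∣m⇒∣n (≡.subst (2 ∣_) 2m≡2n+1 (m∣m*n m)) (m∣m*n n))
... | ()

2*[1+m]+1≢1 : ∀ m → 2 * suc m + 1 ≢ 1
2*[1+m]+1≢1 m eq with +-cancelʳ-≡ 1 (2 * suc m) 0 eq
... | ()

module _ {c ℓ₁ ℓ₂ : Level} (R : OrderedCommSemiring c ℓ₁ ℓ₂) where
  open OrderedCommSemiring R hiding (zero; _≤_) renaming (_+_ to _⊕_; _*_ to _⊗_)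
  open OrderedCommSemiring R using () renaming (_≤_ to _≼_)
  module O = IsDecTotalOrder isDecTotalOrder

  +-nonneg : ∀ {a b} → 0# ≼ a → 0# ≼ b → 0# ≼ a ⊕ b
  +-nonneg {a} {b} 0≤a 0≤b =
    O.trans (O.reflexive (sym (+-identityˡ 0#)))
     (O.trans (+-monoˡ-≤ 0# 0≤a)
      (O.trans (O.reflexive (+-comm a 0#))
       (O.trans (+-monoˡ-≤ a 0≤b) (O.reflexive (+-comm b a)))))

  *-nonneg : ∀ {a b} → 0# ≼ a → 0# ≼ b → 0# ≼ a ⊗ b
  *-nonneg {a} 0≤a 0≤b = O.trans (O.reflexive (sym (zeroʳ a))) (*-monoˡ-≤ 0≤a 0≤b)

  nonneg≈0-if-1≤0 : 1# ≼ 0# → ∀ {a} → 0# ≼ a → a ≈ 0#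
  nonneg≈0-if-1≤0 1≤0 {a} 0≤a = O.antisym
    (O.trans (O.reflexive (sym (*-identityʳ a)))
     (O.trans (*-monoˡ-≤ 0≤a 1≤0) (O.reflexive (zeroʳ a))))
    0≤a

  zeroˡ² : ∀ a b → (0# ⊗ a) ⊗ b ≈ 0#
  zeroˡ² a b = trans (*-congʳ (zeroˡ a)) (zeroˡ b)

  IsZero : ∀ {d} → Vect R d → Set ℓ₁
  IsZero v = ∀ k → v k ≈ 0#

  sumFin-cong : ∀ d {f g : Fin d → Carrier} → (∀ i → f i ≈ g i) → sumFin R d f ≈ sumFin R d g
  sumFin-cong ℕ.zero f≈g = refl
  sumFin-cong (suc d) f≈g = +-cong (f≈g zero) (sumFin-cong d (λ i → f≈g (suc i)))

  sumFin-zero : ∀ d {f : Fin d → Carrier} → IsZero f → sumFin R d f ≈ 0#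
  sumFin-zero ℕ.zero f≈0 = refl
  sumFin-zero (suc d) f≈0 =
    trans (+-cong (f≈0 zero) (sumFin-zero d (λ i → f≈0 (suc i)))) (+-identityˡ 0#)

  sumFin-nonneg : ∀ d {f : Fin d → Carrier} → (∀ i → 0# ≼ f i) → 0# ≼ sumFin R d f
  sumFin-nonneg ℕ.zero 0≤f = O.refl
  sumFin-nonneg (suc d) 0≤f = +-nonneg (0≤f zero) (sumFin-nonneg d (λ i → 0≤f (suc i)))

  module _ {d : ℕ} (coef : Bilinear R d) where

    apply-cong : ∀ {x x′ y y′ : Vect R d} → (∀ i → x i ≈ x′ i) → (∀ j → y j ≈ y′ j) →
                 ∀ k → apply R coef x y k ≈ apply R coef x′ y′ k
    apply-cong x≈x′ y≈y′ k =
      sumFin-cong d (λ i → sumFin-cong d (λ j → *-cong (*-congˡ (x≈x′ i)) (y≈y′ j)))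

    apply-zeroˡ : ∀ {x} (y : Vect R d) → IsZero x → IsZero (apply R coef x y)
    apply-zeroˡ y x≈0 k = sumFin-zero d (λ i → sumFin-zero d (λ j →
      trans (*-congʳ (trans (*-congˡ (x≈0 i)) (zeroʳ (coef k i j)))) (zeroˡ (y j))))

    apply-zeroʳ : ∀ (x : Vect R d) {y} → IsZero y → IsZero (apply R coef x y)
    apply-zeroʳ x y≈0 k = sumFin-zero d (λ i → sumFin-zero d (λ j →
      trans (*-congˡ (y≈0 j)) (zeroʳ (coef k i j ⊗ x i))))

    eval-nonneg : ∀ (s : Vect R d) → NonnegCoeffs R coef → NonnegVect R s →
                  ∀ {n} (X : Comb R n) → NonnegVect R (eval R coef s X)
    eval-nonneg s nc ns leaf k = ns k
    eval-nonneg s nc ns (node X Y) k = sumFin-nonneg d (λ i → sumFin-nonneg d (λ j →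
      *-nonneg (*-nonneg (nc k i j) (eval-nonneg s nc ns X i)) (eval-nonneg s nc ns Y j)))

  rightComb : ∀ n → Comb R (suc n)
  rightComb ℕ.zero = leaf
  rightComb (suc n) = node leaf (rightComb n)

  transportComb : ∀ {ℓ} (P : ∀ {n} → Comb R n → Set ℓ) {a b} → a ≡ b →
                  Σ (Comb R a) P → Σ (Comb R b) P
  transportComb P ≡.refl X = X

  bounded-by-0⇒IsG-0 : ∀ {d n} (coef : Bilinear R (suc d)) s →
                       NonnegCoeffs R coef → NonnegVect R s →
                       (∀ (X : Comb R (suc n)) k → eval R coef s X k ≼ 0#) → IsG R coef s (suc n) 0#
  bounded-by-0⇒IsG-0 {n = n} coef s nc ns bound = (X , zero , X₀≈0) , bound
    where
    X : Comb R (suc n)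
    X = rightComb n
    X₀≈0 : eval R coef s X zero ≈ 0#
    X₀≈0 = O.antisym (bound X zero) (eval-nonneg coef s nc ns X zero)

  seedScale : ∀ {d} {s : Vect R d} → NonnegVect R s →
              Σ Carrier (λ t → 0# ≼ t × (∀ k → (s k ⊗ t) ⊗ t ≈ s k))
  seedScale {s = s} ns with O.total 0# 1#
  ... | inj₁ 0≤1 = 1# , 0≤1 , λ k → trans (*-identityʳ _) (*-identityʳ (s k))
  ... | inj₂ 1≤0 = 0# , O.refl , λ k → trans (zeroʳ _) (sym (nonneg≈0-if-1≤0 1≤0 (ns k)))

  module Doubling {d : ℕ} (coef : Bilinear R (suc d)) (s : Vect R (suc d))
                  (nc : NonnegCoeffs R coef) (ns : NonnegVect R s)
                  (t : Carrier) (0≤t : 0# ≼ t) (scale : ∀ k → (s k ⊗ t) ⊗ t ≈ s k) where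

    coef′ : Bilinear R (suc (suc d))
    coef′ zero    _       _       = 0#
    coef′ (suc k) zero    zero    = s k
    coef′ (suc k) zero    (suc j) = 0#
    coef′ (suc k) (suc i) zero    = 0#
    coef′ (suc k) (suc i) (suc j) = coef k i j

    s′ : Vect R (suc (suc d))
    s′ zero    = t
    s′ (suc i) = 0#

    coef′-nonneg : NonnegCoeffs R coef′
    coef′-nonneg zero    _       _       = O.refl
    coef′-nonneg (suc k) zero    zero    = ns k
    coef′-nonneg (suc k) zero    (suc j) = O.refl
    coef′-nonneg (suc k) (suc i) zero    = O.refl
    coef′-nonneg (suc k) (suc i) (suc j) = nc k i j

    s′-nonneg : NonnegVect R s′
    s′-nonneg zero    = 0≤t
    s′-nonneg (suc i) = O.refl

    _*′_ : Vect R (suc (suc d)) → Vect R (suc (suc d)) → Vect R (suc (suc d))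
    _*′_ = apply R coef′

    ev : ∀ {n} → Comb R n → Vect R (suc d)
    ev = eval R coef s

    ev′ : ∀ {n} → Comb R n → Vect R (suc (suc d))
    ev′ = eval R coef′ s′

    head-*′ : ∀ x y → head (x *′ y) ≈ 0#
    head-*′ x y = sumFin-zero _ (λ i → sumFin-zero _ (λ j → zeroˡ² (x i) (y j)))

    tail-*′ : ∀ x y k →
              tail (x *′ y) k ≈ (s k ⊗ head x) ⊗ head y ⊕ apply R coef (tail x) (tail y) k
    tail-*′ x y k = +-cong marker-row copy-rows
      where
      marker-row : (s k ⊗ head x) ⊗ head y ⊕ sumFin R (suc d) (λ j → (0# ⊗ head x) ⊗ tail y j)
                 ≈ (s k ⊗ head x) ⊗ head y
      marker-row = trans (+-congˡ (sumFin-zero (suc d) (λ j → zeroˡ² (head x) (tail y j))))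
                         (+-identityʳ _)
      copy-rows : sumFin R (suc d) (λ i → (0# ⊗ tail x i) ⊗ head y
                    ⊕ sumFin R (suc d) (λ j → (coef k i j ⊗ tail x i) ⊗ tail y j))
                ≈ apply R coef (tail x) (tail y) k
      copy-rows = sumFin-cong (suc d)
        {g = λ i → sumFin R (suc d) (λ j → (coef k i j ⊗ tail x i) ⊗ tail y j)}
        (λ i → trans (+-congʳ (zeroˡ² (tail x i) (head y))) (+-identityˡ _))

    IsSeed : Vect R (suc (suc d)) → Set ℓ₁
    IsSeed v = head v ≈ t × IsZero (tail v)

    Encodes : Vect R (suc (suc d)) → Vect R (suc d) → Set ℓ₁
    Encodes v w = head v ≈ 0# × (∀ k → tail v k ≈ w k)

    seed-*′-seed : ∀ x y → IsSeed x → IsSeed y → Encodes (x *′ y) s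
    seed-*′-seed x y (x₀≈t , x-tail≈0) (y₀≈t , _) = head-*′ x y , λ k → begin
      tail (x *′ y) k
        ≈⟨ tail-*′ x y k ⟩
      (s k ⊗ head x) ⊗ head y ⊕ apply R coef (tail x) (tail y) k
        ≈⟨ +-cong (*-cong (*-congˡ x₀≈t) y₀≈t) (apply-zeroˡ coef (tail y) x-tail≈0 k) ⟩
      (s k ⊗ t) ⊗ t ⊕ 0#
        ≈⟨ trans (+-identityʳ _) (scale k) ⟩
      s k ∎
      where open ≈-Reasoning setoid

    encodes-*′ : ∀ x y {x₀ y₀} → Encodes x x₀ → Encodes y y₀ →
                 Encodes (x *′ y) (apply R coef x₀ y₀)
    encodes-*′ x y {x₀} {y₀} (x-head≈0 , x≈x₀) (_ , y≈y₀) = head-*′ x y , λ k → begin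
      tail (x *′ y) k
        ≈⟨ tail-*′ x y k ⟩
      (s k ⊗ head x) ⊗ head y ⊕ apply R coef (tail x) (tail y) k
        ≈⟨ +-cong (trans (*-congʳ (trans (*-congˡ x-head≈0) (zeroʳ (s k)))) (zeroˡ (head y)))
                  (apply-cong coef x≈x₀ y≈y₀ k) ⟩
      0# ⊕ apply R coef x₀ y₀ k
        ≈⟨ +-identityˡ _ ⟩
      apply R coef x₀ y₀ k ∎
      where open ≈-Reasoning setoid

    *′-zero : ∀ x y → (head x ≈ 0# ⊎ head y ≈ 0#) → (IsZero (tail x) ⊎ IsZero (tail y)) →
              IsZero (x *′ y)
    *′-zero x y _ _ zero = head-*′ x y
    *′-zero x y heads tails (suc k) =
      trans (tail-*′ x y k) (trans (+-cong (marker heads) (copies tails)) (+-identityˡ 0#))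
      where
      marker : (head x ≈ 0# ⊎ head y ≈ 0#) → (s k ⊗ head x) ⊗ head y ≈ 0#
      marker (inj₁ x₀≈0) = trans (*-congʳ (trans (*-congˡ x₀≈0) (zeroʳ (s k)))) (zeroˡ (head y))
      marker (inj₂ y₀≈0) = trans (*-congˡ y₀≈0) (zeroʳ (s k ⊗ head x))
      copies : (IsZero (tail x) ⊎ IsZero (tail y)) → apply R coef (tail x) (tail y) k ≈ 0#
      copies (inj₁ x≈0) = apply-zeroˡ coef (tail y) x≈0 k
      copies (inj₂ y≈0) = apply-zeroʳ coef (tail x) y≈0 k

    data Shape {n : ℕ} (T : Comb R n) : Set (c ⊔ ℓ₁) where
      seed    : n ≡ 1 → IsSeed (ev′ T) → Shape T
      null    : IsZero (ev′ T) → Shape T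
      encoded : ∀ m (X : Comb R m) → n ≡ 2 * m → Encodes (ev′ T) (ev X) → Shape T

    null-node : ∀ {n₁ n₂} (X : Comb R n₁) (Y : Comb R n₂) →
                (head (ev′ X) ≈ 0# ⊎ head (ev′ Y) ≈ 0#) →
                (IsZero (tail (ev′ X)) ⊎ IsZero (tail (ev′ Y))) → Shape (node X Y)
    null-node X Y heads tails = null (*′-zero (ev′ X) (ev′ Y) heads tails)

    shape-node : ∀ {n₁ n₂} (X : Comb R n₁) (Y : Comb R n₂) → Shape X → Shape Y → Shape (node X Y)
    shape-node X Y (seed n₁≡1 x) (seed n₂≡1 y) =
      encoded 1 leaf (≡.cong₂ _+_ n₁≡1 n₂≡1) (seed-*′-seed (ev′ X) (ev′ Y) x y)
    shape-node X Y (seed _ x) (null y)          = null-node X Y (inj₂ (y zero)) (inj₁ (proj₂ x))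
    shape-node X Y (seed _ x) (encoded _ _ _ y) = null-node X Y (inj₂ (proj₁ y)) (inj₁ (proj₂ x))
    shape-node X Y (null x) _                   = null-node X Y (inj₁ (x zero)) (inj₁ (x ∘ suc))
    shape-node X Y (encoded _ _ _ x) (seed _ y) = null-node X Y (inj₁ (proj₁ x)) (inj₂ (proj₂ y))
    shape-node X Y (encoded _ _ _ x) (null y)   = null-node X Y (inj₁ (proj₁ x)) (inj₂ (y ∘ suc))
    shape-node X Y (encoded m₁ X₁ n₁≡2m₁ x) (encoded m₂ X₂ n₂≡2m₂ y) =
      encoded (m₁ + m₂) (node X₁ X₂)
              (≡.trans (≡.cong₂ _+_ n₁≡2m₁ n₂≡2m₂) (≡.sym (*-distribˡ-+ 2 m₁ m₂)))
              (encodes-*′ (ev′ X) (ev′ Y) x y)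

    shape : ∀ {n} (T : Comb R n) → Shape T
    shape leaf       = seed ≡.refl (refl , λ _ → refl)
    shape (node X Y) = shape-node X Y (shape X) (shape Y)

    doubleComb : ∀ {m} (X : Comb R m) → Σ (Comb R (2 * m)) (λ T → Encodes (ev′ T) (ev X))
    doubleComb leaf = node leaf leaf , seed-*′-seed s′ s′ (refl , λ _ → refl) (refl , λ _ → refl)
    doubleComb (node {m₁} {m₂} X Y) with doubleComb X | doubleComb Y
    ... | T₁ , t₁ | T₂ , t₂ =
      transportComb (λ T → Encodes (ev′ T) (ev (node X Y))) (≡.sym (*-distribˡ-+ 2 m₁ m₂))
                    (node T₁ T₂ , encodes-*′ (ev′ T₁) (ev′ T₂) t₁ t₂)

    even-shape : ∀ m (T : Comb R (2 * m)) →
                 IsZero (ev′ T) ⊎ Σ (Comb R m) (λ X → Encodes (ev′ T) (ev X))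
    even-shape m T with shape T
    ... | seed 2m≡1 _ = ⊥-elim (2*m≢2*n+1 m 0 2m≡1)
    ... | null T≈0 = inj₁ T≈0
    ... | encoded m′ X 2m≡2m′ T≈X =
      inj₂ (transportComb (λ X → Encodes (ev′ T) (ev X)) (*-cancelˡ-≡ m′ m 2 (≡.sym 2m≡2m′))
                          (X , T≈X))

    odd-zero : ∀ m → 1 ≤ m → (T : Comb R (2 * m + 1)) → IsZero (ev′ T)
    odd-zero (suc m) _ T with shape T
    ... | seed 2m+1≡1 _ = ⊥-elim (2*[1+m]+1≢1 m 2m+1≡1)
    ... | null T≈0 = T≈0
    ... | encoded m′ X 2m+1≡2m′ _ = ⊥-elim (2*m≢2*n+1 m′ (suc m) (≡.sym 2m+1≡2m′))

    IsG-odd : ∀ m → 1 ≤ m → IsG R coef′ s′ (2 * m + 1) 0#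
    IsG-odd (suc m) 1≤m = bounded-by-0⇒IsG-0 coef′ s′ coef′-nonneg s′-nonneg
      (λ T k → O.reflexive (odd-zero (suc m) 1≤m T k))

    IsG-even : ∀ m → 1 ≤ m → (v : Carrier) → IsG R coef s m v ⇔ IsG R coef′ s′ (2 * m) v
    IsG-even (suc m) _ v = mk⇔ to from
      where
      to : IsG R coef s (suc m) v → IsG R coef′ s′ (2 * suc m) v
      to ((X , k , Xₖ≈v) , bound) =
        (proj₁ (doubleComb X) , suc k , trans (proj₂ (proj₂ (doubleComb X)) k) Xₖ≈v) , bound′
        where
        0≤v : 0# ≼ v
        0≤v = O.trans (eval-nonneg coef s nc ns X k) (O.reflexive Xₖ≈v)
        bound′ : ∀ (T : Comb R (2 * suc m)) k → ev′ T k ≼ v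
        bound′ T k with even-shape (suc m) T
        bound′ T k       | inj₁ T≈0 = O.trans (O.reflexive (T≈0 k)) 0≤v
        bound′ T zero    | inj₂ (X′ , T₀≈0 , _) = O.trans (O.reflexive T₀≈0) 0≤v
        bound′ T (suc k) | inj₂ (X′ , _ , T≈X′) = O.trans (O.reflexive (T≈X′ k)) (bound X′ k)

      from : IsG R coef′ s′ (2 * suc m) v → IsG R coef s (suc m) v
      from ((T , k , Tₖ≈v) , bound′) = attained k Tₖ≈v
        where
        bound : ∀ (X : Comb R (suc m)) k → ev X k ≼ v
        bound X k = O.trans (O.reflexive (sym (proj₂ (proj₂ (doubleComb X)) k)))
                            (bound′ (proj₁ (doubleComb X)) (suc k))
        attained-zero : v ≈ 0# → IsG R coef s (suc m) v
        attained-zero v≈0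
          with bounded-by-0⇒IsG-0 coef s nc ns (λ X k → O.trans (bound X k) (O.reflexive v≈0))
        ... | (X , k , Xₖ≈0) , _ = (X , k , trans Xₖ≈0 (sym v≈0)) , bound
        attained : ∀ k → ev′ T k ≈ v → IsG R coef s (suc m) v
        attained k Tₖ≈v with even-shape (suc m) T
        attained k       Tₖ≈v | inj₁ T≈0 = attained-zero (trans (sym Tₖ≈v) (T≈0 k))
        attained zero    Tₖ≈v | inj₂ (_ , T₀≈0 , _) = attained-zero (trans (sym Tₖ≈v) T₀≈0)
        attained (suc k) Tₖ≈v | inj₂ (X , _ , T≈X) = (X , k , trans (sym (T≈X k)) Tₖ≈v) , bound

proposition2 : {c ℓ₁ ℓ₂ : Level} (R : OrderedCommSemiring c ℓ₁ ℓ₂) →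
    (d : ℕ) → (coef : Bilinear R (suc d)) → (s : Vect R (suc d)) →
    NonnegCoeffs R coef → NonnegVect R s →
    Σ ℕ (λ d′ → Σ (Bilinear R (suc d′)) (λ coef′ → Σ (Vect R (suc d′)) (λ s′ →
      NonnegCoeffs R coef′ × NonnegVect R s′ ×
      ((m : ℕ) → 1 ≤ m →
        IsG R coef′ s′ (2 * m + 1) (OrderedCommSemiring.0# R)
        × ((v : OrderedCommSemiring.Carrier R) → IsG R coef s m v ⇔ IsG R coef′ s′ (2 * m) v)))))
proposition2 R d coef s nc ns with seedScale R ns
... | t , 0≤t , scale =
  suc d , coef′ , s′ , coef′-nonneg , s′-nonneg , λ m 1≤m → IsG-odd m 1≤m , IsG-even m 1≤m
  where open Doubling R coef s nc ns t 0≤t scale
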